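{- Let $D=(D_1,\dots,D_L)$ be a sequence of real numbers and let $1\le i\le j\le L$. If $a=\max B(i)$ and $a\ge j$, then $a=\max B(j)$.
   Context: For a sequence $F$ of reals and $1\le s\le t\le |F|$ write $\bar F(s,t)$ for the average of $F_s,\dots,F_t$. An index $1\le k\le |F|$ is a border of $F$ if there is a (possibly empty) sequence $E$ such that, with $G$ the concatenation of $F$ and $E$, $\bar G(k,|G|)=\max_{1\le s\le |G|}\bar G(s,|G|)$. For $1\le i\le L$, $B(i)$ denotes the set of indices $b$ with $i\le b\le L$ such that $b-i+1$ is a border of the sequence $(D_i,\dots,D_L)$. -}

module Defs where

open import Data.Nat as ℕ using (ℕ; zero; suc) renaming (_≤_ to _≤ℕ_)
open import Data.List using (List; []; _∷_; length; take; drop; _++_)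
open import Data.Product using (Σ; ∃; _×_; _,_)
open import Data.Sum using (_⊎_)
open import Relation.Binary.PropositionalEquality using (_≡_)
open import Relation.Nullary using (¬_)
open import Algebra.Structures using (IsCommutativeRing)

-- The real numbers, axiomatised as a complete ordered field
-- (unique up to isomorphism).  Every concept below is parametrised by it.
record RealField : Set₁ where
  infixl 6 _+_
  infixl 7 _*_
  infix 4 _≤_
  field
    ℝ    : Set
    _+_  : ℝ → ℝ → ℝ
    _*_  : ℝ → ℝ → ℝ
    -_   : ℝ → ℝ
    0ℝ   : ℝ
    1ℝ   : ℝ
    _⁻¹  : ℝ → ℝ
    _≤_  : ℝ → ℝ → Set
    isCommutativeRing : IsCommutativeRing _≡_ _+_ _*_ -_ 0ℝ 1ℝ
    0≢1       : ¬ (0ℝ ≡ 1ℝ)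
    ⁻¹-inverse : ∀ x → ¬ (x ≡ 0ℝ) → x * (x ⁻¹) ≡ 1ℝ
    ≤-refl    : ∀ {x} → x ≤ x
    ≤-trans   : ∀ {x y z} → x ≤ y → y ≤ z → x ≤ z
    ≤-antisym : ∀ {x y} → x ≤ y → y ≤ x → x ≡ y
    ≤-total   : ∀ x y → x ≤ y ⊎ y ≤ x
    +-mono-≤  : ∀ {x y} z → x ≤ y → x + z ≤ y + z
    *-nonneg  : ∀ {x y} → 0ℝ ≤ x → 0ℝ ≤ y → 0ℝ ≤ x * y
    complete  : (P : ℝ → Set) → (∃ λ x → P x) → (∃ λ b → ∀ x → P x → x ≤ b) →
                ∃ λ s → (∀ x → P x → x ≤ s) × (∀ b → (∀ x → P x → x ≤ b) → s ≤ b)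

module _ (R : RealField) where
  open RealField R

  fromℕ : ℕ → ℝ
  fromℕ zero    = 0ℝ
  fromℕ (suc n) = 1ℝ + fromℕ n

  sumℝ : List ℝ → ℝ
  sumℝ []       = 0ℝ
  sumℝ (x ∷ xs) = x + sumℝ xs

  -- F̄(s,t) : average of F_s,…,F_t (1-based indices, 1 ≤ s ≤ t ≤ |F|)
  avg : List ℝ → ℕ → ℕ → ℝ
  avg F s t = sumℝ (take (suc (t ℕ.∸ s)) (drop (s ℕ.∸ 1) F)) * (fromℕ (suc (t ℕ.∸ s)) ⁻¹)

  IsBorder : List ℝ → ℕ → Set
  IsBorder F k =
    1 ≤ℕ k × k ≤ℕ length F ×
    ∃ λ (E : List ℝ) →
      ∀ s → 1 ≤ℕ s → s ≤ℕ length (F ++ E) →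
        avg (F ++ E) s (length (F ++ E)) ≤ avg (F ++ E) k (length (F ++ E))

  InB : List ℝ → ℕ → ℕ → Set
  InB D i b = i ≤ℕ b × b ≤ℕ length D × IsBorder (drop (i ℕ.∸ 1) D) (suc (b ℕ.∸ i))

  IsMaxB : List ℝ → ℕ → ℕ → Set
  IsMaxB D i a = InB D i a × (∀ b → InB D i b → b ≤ℕ a)

module Submission where

-- We work with 0-based offsets.  By unfolding the averages, k+1 is a border of F
-- exactly when some extension G = F ++ E has its suffix at offset k of largest mean
-- among all suffixes of G (a "maximal suffix", `MaxSuffix G k`).
-- Then a ∈ B(j) by relativising the border of D_i… at a to D_j…, and every b ∈ B(j)
-- with b > a would splice into b ∈ B(i), contradicting a = max B(i).

open import Defs
open import Data.Nat as ℕ using (ℕ; zero; suc; _∸_; z≤n; s≤s)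
  renaming (_≤_ to _≤ℕ_; _<_ to _<ℕ_)
import Data.Nat.Properties as ℕₚ
open import Data.List using (List; []; _∷_; length; take; drop; _++_)
open import Data.List.Properties
  using (length-take; length-drop; take-all; take++drop≡id; drop-drop; ++-assoc; length-++)
open import Data.Product using (∃; _,_)
open import Data.Sum using (inj₁; inj₂)
open import Data.Empty using (⊥-elim)
open import Function.Bundles using (_⇔_; mk⇔; module Equivalence)
open import Relation.Binary.PropositionalEquality
  using (_≡_; refl; sym; trans; cong; cong₂; subst; subst₂; module ≡-Reasoning)
open import Relation.Nullary using (¬_; yes; no)
open import Algebra.Bundles using (Ring)
open import Algebra.Structures using (IsCommutativeRing; IsRing)

open Equivalence using (to; from)

module _ {A : Set} where

  drop-++ˡ : ∀ n (xs ys : List A) → n ≤ℕ length xs → drop n (xs ++ ys) ≡ drop n xs ++ ys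
  drop-++ˡ zero    xs       ys _       = refl
  drop-++ˡ (suc n) (x ∷ xs) ys (s≤s n≤) = drop-++ˡ n xs ys n≤

  drop-drop-∸ : ∀ {σ p} (xs : List A) → σ ≤ℕ p → drop (p ∸ σ) (drop σ xs) ≡ drop p xs
  drop-drop-∸ {σ} {p} xs σ≤p = trans (drop-drop σ (p ∸ σ) xs) (cong (λ k → drop k xs) (ℕₚ.m+[n∸m]≡n σ≤p))

  drop-nonempty : ∀ p (xs : List A) → p <ℕ length xs → 0 <ℕ length (drop p xs)
  drop-nonempty p xs p< = subst (0 <ℕ_) (sym (length-drop p xs)) (ℕₚ.m<n⇒0<n∸m p<)

  segment : ℕ → ℕ → List A → List A
  segment p α xs = take (α ∸ p) (drop p xs)

  segment-nonempty : ∀ {p α} (xs : List A) → p <ℕ α → α ≤ℕ length xs → 0 <ℕ length (segment p α xs)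
  segment-nonempty {p} {α} xs p<α α≤ = subst (0 <ℕ_) (sym (length-take (α ∸ p) (drop p xs)))
    (ℕₚ.⊓-glb (ℕₚ.m<n⇒0<n∸m p<α) (drop-nonempty p xs (ℕₚ.<-≤-trans p<α α≤)))

  drop-split : ∀ {p α} (xs ys : List A) → p ≤ℕ α → α ≤ℕ length xs →
               drop p (xs ++ ys) ≡ segment p α xs ++ drop α (xs ++ ys)
  drop-split {p} {α} xs ys p≤α α≤ = begin
    drop p (xs ++ ys)                      ≡⟨ drop-++ˡ p xs ys (ℕₚ.≤-trans p≤α α≤) ⟩
    drop p xs ++ ys                        ≡⟨ cong (_++ ys) (sym (take++drop≡id (α ∸ p) (drop p xs))) ⟩
    (segment p α xs ++ drop (α ∸ p) (drop p xs)) ++ ys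
                                           ≡⟨ ++-assoc (segment p α xs) _ ys ⟩
    segment p α xs ++ (drop (α ∸ p) (drop p xs) ++ ys)
                                           ≡⟨ cong (λ zs → segment p α xs ++ (zs ++ ys)) (drop-drop-∸ xs p≤α) ⟩
    segment p α xs ++ (drop α xs ++ ys)    ≡⟨ cong (segment p α xs ++_) (sym (drop-++ˡ α xs ys α≤)) ⟩
    segment p α xs ++ drop α (xs ++ ys)    ∎
    where open ≡-Reasoning

  length-++ˡ : ∀ (xs ys : List A) → length xs ≤ℕ length (xs ++ ys)
  length-++ˡ xs ys = subst (length xs ≤ℕ_) (sym (length-++ xs)) (ℕₚ.m≤m+n _ _)

<∸⇒+< : ∀ {σ p n} → p <ℕ n ∸ σ → σ ℕ.+ p <ℕ n
<∸⇒+< {σ} {p} {n} p< = subst (σ ℕ.+ p <ℕ_) (ℕₚ.m+[n∸m]≡n (ℕₚ.<⇒≤ σ<n)) (ℕₚ.+-monoʳ-< σ p<)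
  where σ<n = ℕₚ.m∸n≢0⇒n<m {n} {σ} (ℕₚ.m<n⇒n≢0 p<)

module OrderedField (R : RealField) where
  open RealField R
  open IsCommutativeRing isCommutativeRing using (isRing; *-comm)
  open IsRing isRing
    using (+-assoc; +-comm; +-identityˡ; +-identityʳ; -‿inverseˡ; -‿inverseʳ;
           *-assoc; *-identityʳ; distribʳ; zeroˡ)

  private
    ring : Ring _ _
    ring = record { isRing = isRing }
  open import Algebra.Properties.Ring ring using (-‿distribˡ-*; -1*x≈-x; -‿involutive)

  +-monoʳ-≤ : ∀ {x y} z → x ≤ y → z + x ≤ z + y
  +-monoʳ-≤ {x} {y} z x≤y = subst₂ _≤_ (+-comm x z) (+-comm y z) (+-mono-≤ z x≤y)

  +-mono₂-≤ : ∀ {x y z w} → x ≤ y → z ≤ w → x + z ≤ y + w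
  +-mono₂-≤ {y = y} {z = z} x≤y z≤w = ≤-trans (+-mono-≤ z x≤y) (+-monoʳ-≤ y z≤w)

  private
    +-cancel-neg : ∀ x z → (x + z) + - z ≡ x
    +-cancel-neg x z = trans (+-assoc x z (- z)) (trans (cong (x +_) (-‿inverseʳ z)) (+-identityʳ x))

  +-cancelʳ-≤ : ∀ {x y} z → x + z ≤ y + z → x ≤ y
  +-cancelʳ-≤ {x} {y} z p = subst₂ _≤_ (+-cancel-neg x z) (+-cancel-neg y z) (+-mono-≤ (- z) p)

  +-cancel-≤ : ∀ {x y z z'} → x + z ≤ y + z' → z' ≤ z → x ≤ y
  +-cancel-≤ {x} {z' = z'} p z'≤z = +-cancelʳ-≤ z' (≤-trans (+-monoʳ-≤ x z'≤z) p)

  -- Multiplying by a nonnegative element is monotone: (y − x)·z ≥ 0, then add x·z.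
  *-monoʳ-≤ : ∀ {x y z} → 0ℝ ≤ z → x ≤ y → x * z ≤ y * z
  *-monoʳ-≤ {x} {y} {z} 0≤z x≤y =
    subst₂ _≤_ (+-identityˡ (x * z)) difference-cancels (+-mono-≤ (x * z) (*-nonneg 0≤y-x 0≤z))
    where
    0≤y-x : 0ℝ ≤ y + - x
    0≤y-x = subst (_≤ y + - x) (-‿inverseʳ x) (+-mono-≤ (- x) x≤y)
    difference-cancels : (y + - x) * z + x * z ≡ y * z
    difference-cancels = begin
      (y + - x) * z + x * z         ≡⟨ cong (_+ x * z) (distribʳ z y (- x)) ⟩
      (y * z + - x * z) + x * z     ≡⟨ cong (λ t → (y * z + t) + x * z) (sym (-‿distribˡ-* x z)) ⟩
      (y * z + - (x * z)) + x * z   ≡⟨ +-assoc (y * z) (- (x * z)) (x * z) ⟩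
      y * z + (- (x * z) + x * z)   ≡⟨ cong (y * z +_) (-‿inverseˡ (x * z)) ⟩
      y * z + 0ℝ                    ≡⟨ +-identityʳ (y * z) ⟩
      y * z                         ∎
      where open ≡-Reasoning

  -- If 1 ≤ 0 then 0 ≤ −1, so 0 ≤ (−1)(−1) = 1, forcing 0 = 1.
  1≰0 : ¬ (1ℝ ≤ 0ℝ)
  1≰0 1≤0 = 0≢1 (≤-antisym 0≤1 1≤0)
    where
    0≤-1 : 0ℝ ≤ - 1ℝ
    0≤-1 = subst₂ _≤_ (-‿inverseʳ 1ℝ) (+-identityˡ (- 1ℝ)) (+-mono-≤ (- 1ℝ) 1≤0)
    0≤1 : 0ℝ ≤ 1ℝ
    0≤1 = subst (0ℝ ≤_) (trans (-1*x≈-x (- 1ℝ)) (-‿involutive 1ℝ)) (*-nonneg 0≤-1 0≤-1)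

  0≤1 : 0ℝ ≤ 1ℝ
  0≤1 with ≤-total 0ℝ 1ℝ
  ... | inj₁ 0≤1 = 0≤1
  ... | inj₂ 1≤0 = ⊥-elim (1≰0 1≤0)

  fromℕ-nonneg : ∀ n → 0ℝ ≤ fromℕ R n
  fromℕ-nonneg zero    = ≤-refl
  fromℕ-nonneg (suc n) = subst (_≤ 1ℝ + fromℕ R n) (+-identityˡ 0ℝ) (+-mono₂-≤ 0≤1 (fromℕ-nonneg n))

  -- From here on, w = n + 1 as a real: it is ≥ 1, hence invertible with w⁻¹ ≥ 0.
  fromℕ-suc≢0 : ∀ n → ¬ (fromℕ R (suc n) ≡ 0ℝ)
  fromℕ-suc≢0 n w≡0 = 1≰0 (subst₂ _≤_ (+-identityʳ 1ℝ) w≡0 (+-monoʳ-≤ 1ℝ (fromℕ-nonneg n)))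

  w⁻¹ : ℕ → ℝ
  w⁻¹ n = fromℕ R (suc n) ⁻¹

  private
    w*w⁻¹ : ∀ n → fromℕ R (suc n) * w⁻¹ n ≡ 1ℝ
    w*w⁻¹ n = ⁻¹-inverse _ (fromℕ-suc≢0 n)

    w⁻¹-nonneg : ∀ n → 0ℝ ≤ w⁻¹ n
    w⁻¹-nonneg n with ≤-total 0ℝ (w⁻¹ n)
    ... | inj₁ 0≤ = 0≤
    ... | inj₂ ≤0 = ⊥-elim (1≰0 (subst₂ _≤_ (trans (*-comm _ _) (w*w⁻¹ n)) (zeroˡ _)
                                         (*-monoʳ-≤ (fromℕ-nonneg (suc n)) ≤0)))

    ÷*-cancel : ∀ x n → (x * w⁻¹ n) * fromℕ R (suc n) ≡ x
    ÷*-cancel x n = trans (*-assoc _ _ _)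
      (trans (cong (x *_) (trans (*-comm _ _) (w*w⁻¹ n))) (*-identityʳ x))

    *÷-cancel : ∀ x n → (x * fromℕ R (suc n)) * w⁻¹ n ≡ x
    *÷-cancel x n = trans (*-assoc _ _ _) (trans (cong (x *_) (w*w⁻¹ n)) (*-identityʳ x))

  ÷-≤⇔ : ∀ {x c} n → (x * w⁻¹ n ≤ c) ⇔ (x ≤ c * fromℕ R (suc n))
  ÷-≤⇔ {x} {c} n = mk⇔
    (λ p → subst (_≤ _) (÷*-cancel x n) (*-monoʳ-≤ (fromℕ-nonneg (suc n)) p))
    (λ p → subst (_ ≤_) (*÷-cancel c n) (*-monoʳ-≤ (w⁻¹-nonneg n) p))

  ≤-÷⇔ : ∀ {x c} n → (c ≤ x * w⁻¹ n) ⇔ (c * fromℕ R (suc n) ≤ x)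
  ≤-÷⇔ {x} {c} n = mk⇔
    (λ p → subst (_ ≤_) (÷*-cancel x n) (*-monoʳ-≤ (fromℕ-nonneg (suc n)) p))
    (λ p → subst (_≤ _) (*÷-cancel c n) (*-monoʳ-≤ (w⁻¹-nonneg n) p))

module Means (R : RealField) where
  open RealField R
  open OrderedField R
  open IsCommutativeRing isCommutativeRing using (isRing)
  open IsRing isRing using (+-assoc; +-identityˡ; distribˡ)

  count : List ℝ → ℝ
  count xs = fromℕ R (length xs)

  -- the mean; it is only used for nonempty lists
  mean : List ℝ → ℝ
  mean xs = sumℝ R xs * (count xs ⁻¹)

  mean-≤⇔ : ∀ {c} xs → 0 <ℕ length xs → (mean xs ≤ c) ⇔ (sumℝ R xs ≤ c * count xs)
  mean-≤⇔ (_ ∷ xs) _ = ÷-≤⇔ (length xs)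

  ≤-mean⇔ : ∀ {c} xs → 0 <ℕ length xs → (c ≤ mean xs) ⇔ (c * count xs ≤ sumℝ R xs)
  ≤-mean⇔ (_ ∷ xs) _ = ≤-÷⇔ (length xs)

  sum-++ : ∀ xs ys → sumℝ R (xs ++ ys) ≡ sumℝ R xs + sumℝ R ys
  sum-++ []       ys = sym (+-identityˡ _)
  sum-++ (x ∷ xs) ys = trans (cong (x +_) (sum-++ xs ys)) (sym (+-assoc _ _ _))

  scaled-count-++ : ∀ c xs ys → c * count (xs ++ ys) ≡ c * count xs + c * count ys
  scaled-count-++ c xs ys = trans (cong (c *_) (count-++ xs ys)) (distribˡ c _ _)
    where
    count-++ : ∀ xs ys → count (xs ++ ys) ≡ count xs + count ys
    count-++ []       ys = sym (+-identityˡ _)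
    count-++ (x ∷ xs) ys = trans (cong (1ℝ +_) (count-++ xs ys)) (sym (+-assoc _ _ _))

  ++-≤⇔ : ∀ {c} xs ys → 0 <ℕ length xs →
          (mean (xs ++ ys) ≤ c) ⇔ (sumℝ R xs + sumℝ R ys ≤ c * count xs + c * count ys)
  ++-≤⇔ {c} xs ys 0<xs = mk⇔
    (λ p → subst₂ _≤_ (sum-++ xs ys) (scaled-count-++ c xs ys) (to (mean-≤⇔ (xs ++ ys) 0<xs++ys) p))
    (λ p → from (mean-≤⇔ (xs ++ ys) 0<xs++ys)
             (subst₂ _≤_ (sym (sum-++ xs ys)) (sym (scaled-count-++ c xs ys)) p))
    where 0<xs++ys = ℕₚ.<-≤-trans 0<xs (length-++ˡ xs ys)

  ++-≥⇔ : ∀ {c} xs ys → 0 <ℕ length xs →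
          (c ≤ mean (xs ++ ys)) ⇔ (c * count xs + c * count ys ≤ sumℝ R xs + sumℝ R ys)
  ++-≥⇔ {c} xs ys 0<xs = mk⇔
    (λ p → subst₂ _≤_ (scaled-count-++ c xs ys) (sum-++ xs ys) (to (≤-mean⇔ (xs ++ ys) 0<xs++ys) p))
    (λ p → from (≤-mean⇔ (xs ++ ys) 0<xs++ys)
             (subst₂ _≤_ (sym (scaled-count-++ c xs ys)) (sym (sum-++ xs ys)) p))
    where 0<xs++ys = ℕₚ.<-≤-trans 0<xs (length-++ˡ xs ys)

  mean-++-≤ : ∀ {c} xs ys → 0 <ℕ length xs → 0 <ℕ length ys →
              mean xs ≤ c → mean ys ≤ c → mean (xs ++ ys) ≤ c
  mean-++-≤ xs ys 0<xs 0<ys xs≤c ys≤c = from (++-≤⇔ xs ys 0<xs)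
    (+-mono₂-≤ (to (mean-≤⇔ xs 0<xs) xs≤c) (to (mean-≤⇔ ys 0<ys) ys≤c))

  prefix-≤-suffix : ∀ xs ys → 0 <ℕ length xs → 0 <ℕ length ys →
                    mean (xs ++ ys) ≤ mean ys → mean xs ≤ mean ys
  prefix-≤-suffix xs ys 0<xs 0<ys p = from (mean-≤⇔ xs 0<xs)
    (+-cancel-≤ (to (++-≤⇔ xs ys 0<xs) p) (to (≤-mean⇔ ys 0<ys) ≤-refl))

  whole-≤-prefix : ∀ xs ys → 0 <ℕ length xs → 0 <ℕ length ys →
                   mean ys ≤ mean (xs ++ ys) → mean (xs ++ ys) ≤ mean xs
  whole-≤-prefix xs ys 0<xs 0<ys p = from (≤-mean⇔ xs 0<xs)
    (+-cancel-≤ (to (++-≥⇔ xs ys 0<xs) ≤-refl) (to (mean-≤⇔ ys 0<ys) p))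

  -- Read U, W, T as consecutive blocks with the
  -- block W ++ T (resp. T') of largest mean at its start in U ++ W ++ T (resp. W ++ T'):
  -- mean U ≤ mean (W ++ T) ≤ mean W ≤ mean T', so U ++ W ++ T' has mean at most mean T'.
  splice-means : ∀ U W T T' → 0 <ℕ length U → 0 <ℕ length W → 0 <ℕ length T → 0 <ℕ length T' →
                 mean (U ++ (W ++ T)) ≤ mean (W ++ T) → mean T ≤ mean (W ++ T) →
                 mean (W ++ T') ≤ mean T' → mean (U ++ (W ++ T')) ≤ mean T'
  splice-means U W T T' 0<U 0<W 0<T 0<T' UWT≤WT T≤WT WT'≤T' =
    mean-++-≤ U (W ++ T') 0<U (ℕₚ.<-≤-trans 0<W (length-++ˡ W T')) U≤T'
      (mean-++-≤ W T' 0<W 0<T' W≤T' ≤-refl)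
    where
    0<WT = ℕₚ.<-≤-trans 0<W (length-++ˡ W T)
    W≤T' : mean W ≤ mean T'
    W≤T' = prefix-≤-suffix W T' 0<W 0<T' WT'≤T'
    U≤T' : mean U ≤ mean T'
    U≤T' = ≤-trans (prefix-≤-suffix U (W ++ T) 0<U 0<WT UWT≤WT)
             (≤-trans (whole-≤-prefix W T 0<W 0<T T≤WT) W≤T')

module MaxSuffixes (R : RealField) where
  open RealField R
  open Means R

  MaxSuffixFrom : ℕ → List ℝ → ℕ → Set
  MaxSuffixFrom σ Y q = ∀ p → σ ≤ℕ p → p <ℕ length Y → mean (drop p Y) ≤ mean (drop q Y)

  MaxSuffix : List ℝ → ℕ → Set
  MaxSuffix = MaxSuffixFrom 0

  maxSuffixFrom⇔drop : ∀ {σ q} Y → σ ≤ℕ q → MaxSuffixFrom σ Y q ⇔ MaxSuffix (drop σ Y) (q ∸ σ)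
  maxSuffixFrom⇔drop {σ} {q} Y σ≤q = mk⇔ restrict extend
    where
    restrict : MaxSuffixFrom σ Y q → MaxSuffix (drop σ Y) (q ∸ σ)
    restrict max-q p _ p< =
      subst₂ (λ u v → mean u ≤ mean v) (sym (drop-drop σ p Y)) (sym (drop-drop-∸ Y σ≤q))
        (max-q (σ ℕ.+ p) (ℕₚ.m≤m+n σ p) (<∸⇒+< (subst (p <ℕ_) (length-drop σ Y) p<)))
    extend : MaxSuffix (drop σ Y) (q ∸ σ) → MaxSuffixFrom σ Y q
    extend max-q p σ≤p p< =
      subst₂ (λ u v → mean u ≤ mean v) (drop-drop-∸ Y σ≤p) (drop-drop-∸ Y σ≤q)
        (max-q (p ∸ σ) z≤n (subst (p ∸ σ <ℕ_) (sym (length-drop σ Y)) (ℕₚ.∸-monoˡ-< p< σ≤p)))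

  -- Let α be a maximal suffix of X ++ E, and let β, with α < β < |X|, be maximal in
  -- X ++ E' among the suffixes starting at σ ≤ α.  Then β is a maximal suffix of X ++ E':
  -- a suffix starting at p < σ is U ++ W ++ T' with U = X[p,α), W = X[α,β), T' the suffix
  -- at β, and `splice-means` applies, its hypotheses coming from α in X ++ E and β in X ++ E'.
  splice : ∀ {σ α β} (X E E' : List ℝ) → σ ≤ℕ α → α <ℕ β → β <ℕ length X →
           MaxSuffix (X ++ E) α → MaxSuffixFrom σ (X ++ E') β → MaxSuffix (X ++ E') β
  splice {σ} {α} {β} X E E' σ≤α α<β β<X max-α max-β p _ p< with σ ℕₚ.≤? p
  ... | yes σ≤p = max-β p σ≤p p<
  ... | no σ≰p  =
    subst (λ u → mean u ≤ mean T') (sym (blocks E'))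
      (splice-means U W T T'
        (segment-nonempty X p<α α≤X) (segment-nonempty X α<β β≤X)
        (drop-nonempty β (X ++ E) (β<X++ E)) (drop-nonempty β (X ++ E') (β<X++ E'))
        (subst₂ (λ u v → mean u ≤ mean v) (blocks E) (split-at-β E)
          (max-α p z≤n (ℕₚ.<-trans p<α (α<X++ E))))
        (subst (λ v → mean T ≤ mean v) (split-at-β E) (max-α β z≤n (β<X++ E)))
        (subst (λ u → mean u ≤ mean T') (split-at-β E') (max-β α σ≤α (α<X++ E'))))
    where
    p<α = ℕₚ.<-≤-trans (ℕₚ.≰⇒> σ≰p) σ≤α
    β≤X = ℕₚ.<⇒≤ β<X
    α≤X = ℕₚ.<⇒≤ (ℕₚ.<-trans α<β β<X)
    U = segment p α X
    W = segment α β X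
    T = drop β (X ++ E)
    T' = drop β (X ++ E')
    β<X++ : ∀ F → β <ℕ length (X ++ F)
    β<X++ F = ℕₚ.<-≤-trans β<X (length-++ˡ X F)
    α<X++ : ∀ F → α <ℕ length (X ++ F)
    α<X++ F = ℕₚ.<-trans α<β (β<X++ F)
    split-at-β : ∀ F → drop α (X ++ F) ≡ W ++ drop β (X ++ F)
    split-at-β F = drop-split X F (ℕₚ.<⇒≤ α<β) β≤X
    blocks : ∀ F → drop p (X ++ F) ≡ U ++ (W ++ drop β (X ++ F))
    blocks F = trans (drop-split X F (ℕₚ.<⇒≤ p<α) α≤X) (cong (U ++_) (split-at-β F))

module Borders (R : RealField) where
  open RealField R
  open Means R
  open MaxSuffixes R

  avg≡mean-suffix : ∀ (G : List ℝ) p → p <ℕ length G → avg R G (suc p) (length G) ≡ mean (drop p G)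
  avg≡mean-suffix G p p< =
    cong₂ (λ xs k → sumℝ R xs * (fromℕ R k ⁻¹)) (take-all _ (drop p G) (ℕₚ.≤-reflexive suffix-length))
      (sym suffix-length)
    where
    suffix-length : length (drop p G) ≡ suc (length G ∸ suc p)
    suffix-length = trans (length-drop p G) (ℕₚ.+-∸-assoc 1 p<)

  border⇒maxSuffix : ∀ F k → IsBorder R F (suc k) → ∃ λ E → MaxSuffix (F ++ E) k
  border⇒maxSuffix F k (_ , k<F , E , largest) = E , λ p _ p< →
    subst₂ _≤_ (avg≡mean-suffix (F ++ E) p p<)
      (avg≡mean-suffix (F ++ E) k (ℕₚ.<-≤-trans k<F (length-++ˡ F E)))
      (largest (suc p) (s≤s z≤n) p<)

  maxSuffix⇒border : ∀ F k E → k <ℕ length F → MaxSuffix (F ++ E) k → IsBorder R F (suc k)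
  maxSuffix⇒border F k E k<F max-k = s≤s z≤n , k<F , E , largest
    where
    largest : ∀ s → 1 ≤ℕ s → s ≤ℕ length (F ++ E) →
              avg R (F ++ E) s (length (F ++ E)) ≤ avg R (F ++ E) (suc k) (length (F ++ E))
    largest (suc p) _ p< =
      subst₂ _≤_ (sym (avg≡mean-suffix (F ++ E) p p<))
        (sym (avg≡mean-suffix (F ++ E) k (ℕₚ.<-≤-trans k<F (length-++ˡ F E))))
        (max-k p z≤n p<)

  offset<length : ∀ (D : List ℝ) i₀ b → suc i₀ ≤ℕ b → b ≤ℕ length D → b ∸ suc i₀ <ℕ length (drop i₀ D)
  offset<length D i₀ b i<b b≤L =
    subst (b ∸ suc i₀ <ℕ_) (sym (length-drop i₀ D))
      (subst (_≤ℕ length D ∸ i₀) (ℕₚ.+-∸-assoc 1 i<b) (ℕₚ.∸-monoˡ-≤ i₀ b≤L))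

  inB⇒maxSuffix : ∀ {D i₀ b} → InB R D (suc i₀) b → ∃ λ E → MaxSuffix (drop i₀ D ++ E) (b ∸ suc i₀)
  inB⇒maxSuffix {D} {i₀} {b} (_ , _ , border) = border⇒maxSuffix (drop i₀ D) (b ∸ suc i₀) border

  maxSuffix⇒inB : ∀ {D i₀ b} E → suc i₀ ≤ℕ b → b ≤ℕ length D →
                  MaxSuffix (drop i₀ D ++ E) (b ∸ suc i₀) → InB R D (suc i₀) b
  maxSuffix⇒inB {D} {i₀} {b} E i≤b b≤L max-b =
    i≤b , b≤L , maxSuffix⇒border (drop i₀ D) (b ∸ suc i₀) E (offset<length D i₀ b i≤b b≤L) max-b

  restart : ∀ (D E : List ℝ) {i₀ j₀ b} → i₀ ≤ℕ j₀ → j₀ ≤ℕ length D → suc j₀ ≤ℕ b →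
            MaxSuffixFrom (j₀ ∸ i₀) (drop i₀ D ++ E) (b ∸ suc i₀) ⇔ MaxSuffix (drop j₀ D ++ E) (b ∸ suc j₀)
  restart D E {i₀} {j₀} {b} i₀≤j₀ j₀≤L j<b =
    subst₂ (λ Y q → MaxSuffixFrom (j₀ ∸ i₀) (drop i₀ D ++ E) (b ∸ suc i₀) ⇔ MaxSuffix Y q)
      same-suffixes same-offset
      (maxSuffixFrom⇔drop (drop i₀ D ++ E) (ℕₚ.∸-monoˡ-≤ (suc i₀) j<b))
    where
    same-suffixes : drop (j₀ ∸ i₀) (drop i₀ D ++ E) ≡ drop j₀ D ++ E
    same-suffixes =
      trans (drop-++ˡ (j₀ ∸ i₀) (drop i₀ D) E
               (subst (j₀ ∸ i₀ ≤ℕ_) (sym (length-drop i₀ D)) (ℕₚ.∸-monoˡ-≤ i₀ j₀≤L)))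
            (cong (_++ E) (drop-drop-∸ D i₀≤j₀))
    same-offset : (b ∸ suc i₀) ∸ (j₀ ∸ i₀) ≡ b ∸ suc j₀
    same-offset = trans (ℕₚ.∸-+-assoc b (suc i₀) (j₀ ∸ i₀)) (cong (λ k → b ∸ suc k) (ℕₚ.m+[n∸m]≡n i₀≤j₀))

-- The statement uses the order of ℕ under its plain name; above, `_≤_` was the order of ℝ.
open import Data.Nat using (_≤_)

corollary1 : (R : RealField) (D : List (RealField.ℝ R)) (i j a : ℕ) →
    1 ≤ i → i ≤ j → j ≤ length D →
    IsMaxB R D i a → j ≤ a → IsMaxB R D j a
corollary1 R D (suc i₀) (suc j₀) a _ i≤j j≤L (a∈Bᵢ@(i≤a , a≤L , _) , a-maximalᵢ) j≤a =
  a∈Bⱼ , a-maximalⱼ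
  where
  open MaxSuffixes R
  open Borders R
  i₀≤j₀ = ℕ.s≤s⁻¹ i≤j
  j₀≤L = ℕₚ.<⇒≤ j≤L

  a∈Bⱼ : InB R D (suc j₀) a
  a∈Bⱼ with inB⇒maxSuffix a∈Bᵢ
  ... | E , max-a = maxSuffix⇒inB E j≤a a≤L (to (restart D E i₀≤j₀ j₀≤L j≤a) (λ p _ → max-a p z≤n))

  -- A border b > a from j would splice with the border a from i into b ∈ B(i).
  a-maximalⱼ : ∀ b → InB R D (suc j₀) b → b ≤ a
  a-maximalⱼ b b∈Bⱼ@(j≤b , b≤L , _) with b ℕₚ.≤? a
  ... | yes b≤a = b≤a
  ... | no b≰a = ⊥-elim (b≰a (a-maximalᵢ b b∈Bᵢ))
    where
    i≤b = ℕₚ.≤-trans i≤j j≤b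
    b∈Bᵢ : InB R D (suc i₀) b
    b∈Bᵢ with inB⇒maxSuffix a∈Bᵢ | inB⇒maxSuffix b∈Bⱼ
    ... | E , max-a | E' , max-b =
      maxSuffix⇒inB E' i≤b b≤L
        (splice (drop i₀ D) E E' (ℕₚ.∸-monoˡ-≤ (suc i₀) j≤a) (ℕₚ.∸-monoˡ-< (ℕₚ.≰⇒> b≰a) i≤a)
           (offset<length D i₀ b i≤b b≤L) max-a (from (restart D E' i₀≤j₀ j₀≤L j≤b) max-b))
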